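{- Suppose an integer topograph is primitive with discriminant $D=m^2$ for an integer $m\ge1$. Then there exist integers $r$ and $s$ with $rs\equiv1\pmod m$ such that the labels of all regions adjacent to the left lake are $\equiv r\pmod m$ and the labels of all regions adjacent to the right lake are $\equiv s\pmod m$.
   Context: A topograph is a tree drawn in the plane with all vertices of degree 3, whose regions are labelled by integers such that for every edge, if $s,t$ label the regions on either side of the edge and $r,u$ label the other regions at its two endpoints, then $r+u=2(s+t)$; the edge directed from the $r$-end to the $u$-end is labelled $s+t-r$ (and its reverse by the negative). If an edge directed with label $b$ has region $a$ on its left and $c$ on its right, then $b^2-4ac$ is the same for every such configuration; this is the discriminant $D$. The topograph is primitive if the gcd of its region labels is $1$. A lake is a region labelled $0$. A topograph of discriminant $m^2$ with $m\ge1$ has exactly two lakes, and the edges separating a positively labelled region from a negatively labelled one form a (possibly empty) path, the river, joining them. Orient the picture so that positive regions lie above the river; the left lake is the one at the left end of the river (its boundary edges, directed clockwise around the lake... equivalently the lake where the river starts when traversed with positive regions on the left) and the right lake is the other. (For $m=1$ the two lakes are adjacent.) -}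

module Defs where

open import Data.Nat using (ℕ)
open import Data.Integer using (ℤ; +_; _+_; _-_; _*_; -_; 0ℤ; 1ℤ; -1ℤ)
open import Data.Integer.GCD using (gcd)
open import Data.Integer.Divisibility using (_∣_)
open import Data.Product using (_×_; _,_)
open import Data.Sum using (_⊎_)
open import Data.Empty using (⊥)
open import Relation.Binary.PropositionalEquality using (_≡_)

-- Concrete model of the (unique) infinite planar trivalent tree:
-- a region is a primitive integer vector (p , q) taken up to sign;
-- two regions v , w are adjacent (share an edge) iff det(v,w) = ±1;
-- the edge between v and w (with det v w ≡ 1) has the regions v + w and
-- v - w at its two endpoints.

V : Set
V = ℤ × ℤ

_⊕_ : V → V → V
(a , b) ⊕ (c , d) = (a + c , b + d)

_⊖_ : V → V → V
(a , b) ⊖ (c , d) = (a - c , b - d)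

neg : V → V
neg (a , b) = (- a , - b)

det : V → V → ℤ
det (a , b) (c , d) = a * d - b * c

IsRegion : V → Set
IsRegion (a , b) = gcd a b ≡ 1ℤ

Adjacent : V → V → Set
Adjacent v w = det v w ≡ 1ℤ ⊎ det v w ≡ -1ℤ

-- A labelling of the regions by integers (values off primitive vectors
-- are irrelevant).
Labelling : Set
Labelling = V → ℤ

IsTopograph : Labelling → Set
IsTopograph f =
  (∀ v → IsRegion v → f (neg v) ≡ f v) ×
  (∀ v w → det v w ≡ 1ℤ → f (v ⊕ w) + f (v ⊖ w) ≡ + 2 * (f v + f w))

-- label of the edge between v and w directed from the (v ⊖ w)-end to the
-- (v ⊕ w)-end: s + t - r
edgeLabel : Labelling → V → V → ℤ
edgeLabel f v w = f v + f w - f (v ⊖ w)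

discAt : Labelling → V → V → ℤ
discAt f v w = edgeLabel f v w * edgeLabel f v w - + 4 * f v * f w

HasDiscriminant : Labelling → ℤ → Set
HasDiscriminant f D = ∀ v w → det v w ≡ 1ℤ → discAt f v w ≡ D

Primitive : Labelling → Set
Primitive f = ∀ (d : ℤ) → (∀ v → IsRegion v → d ∣ f v) → d ∣ 1ℤ

CongMod : ℕ → ℤ → ℤ → Set
CongMod m a b = + m ∣ (a - b)

IsLake : Labelling → V → Set
IsLake f L = IsRegion L × f L ≡ 0ℤ

DistinctRegions : V → V → Set
DistinctRegions v w = (v ≡ w → ⊥) × (v ≡ neg w → ⊥)

{-# OPTIONS --safe #-}

-- Write f in a basis (L, w) of ℤ², where L is a lake and w a neighbour of it. The
-- arithmetic-progression rule makes f the binary quadratic form f(xL + yw) = b·xy + r·y²,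
-- with r = f(w) and b the label of the edge between L and w, and then b² = D = m².
-- A region adjacent to L has y = ±1, so its label is ≡ r (mod b). The other lake
-- L′ = sL + tw satisfies 0 = f(L′) = t(sb + tr) with t ≠ 0; primitivity makes b and r
-- coprime, and s, t are coprime, so b ∣ t and s² = r². A neighbour w′ = xL + yw of L′
-- has sy − tx = 1, hence r·f(w′) ≡ r²y² = s²y² ≡ 1 (mod b).

module Submission where

open import Defs
open import Data.Nat using (ℕ; _≥_)
open import Data.Integer using (ℤ; +_; _*_; 1ℤ)
open import Data.Product using (_×_; Σ)

import Data.Nat as ℕ
open import Data.Nat using (zero; suc)
import Data.Nat.Properties as ℕP
import Data.Nat.Divisibility as ℕD
import Data.Nat.Coprimality as ℕC
open import Data.Nat.GCD using (module Bézout)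
open import Data.Nat.Induction using (<-wellFounded)
open import Induction.WellFounded using (Acc; acc)
open import Data.Integer using (-[1+_]; _+_; _-_; -_; 0ℤ; -1ℤ; ∣_∣; sign; _◃_)
import Data.Integer.Properties as ℤP
import Data.Integer.Divisibility as Unsigned
open import Data.Integer.Divisibility.Signed
  using (_∣_; ∣ᵤ⇒∣; ∣⇒∣ᵤ; ∣-refl; ∣m⇒∣m*n; ∣n⇒∣m*n; ∣m⇒∣-m; ∣m∣n⇒∣m+n; ∣m∣n⇒∣m-n)
open import Data.Integer.Coprimality using (Coprime; coprime-divisor)
import Data.Integer.Coprimality as ℤC
open import Data.Integer.GCD using (gcd; gcd[i,j]∣i; gcd[i,j]∣j; gcd-greatest)
open import Data.Integer.Tactic.RingSolver using (solve-∀; solve)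
open import Data.List using ([]; _∷_)
open import Algebra.Properties.AbelianGroup ℤP.+-0-abelianGroup using (inverseˡ-unique; inverseʳ-unique)
import Data.Sign.Properties as SignP
open import Data.Product using (_,_; proj₁; proj₂)
open import Data.Sum using (_⊎_; inj₁; inj₂; [_,_]′)
import Data.Sum as Sum
open import Data.Empty using (⊥-elim)
open import Function using (id)
open import Relation.Binary.PropositionalEquality
open import Relation.Binary.Definitions using (tri<; tri≈; tri>)
open ≡-Reasoning

-- Integer arithmetic

m*m≡n*n⇒m≡n : ∀ {m n} → m ℕ.* m ≡ n ℕ.* n → m ≡ n
m*m≡n*n⇒m≡n {m} {n} eq with ℕP.<-cmp m n
... | tri< m<n _ _ = ⊥-elim (ℕP.<-irrefl eq (ℕP.*-mono-< m<n m<n))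
... | tri≈ _ m≡n _ = m≡n
... | tri> _ _ n<m = ⊥-elim (ℕP.<-irrefl (sym eq) (ℕP.*-mono-< n<m n<m))

i*i≡∣i∣*∣i∣ : ∀ i → i * i ≡ + (∣ i ∣ ℕ.* ∣ i ∣)
i*i≡∣i∣*∣i∣ i = trans (cong (_◃ (∣ i ∣ ℕ.* ∣ i ∣)) (SignP.s*s≡+ (sign i))) (ℤP.+◃n≡+n _)

i*i≡j*j⇒∣i∣≡∣j∣ : ∀ {i j} → i * i ≡ j * j → ∣ i ∣ ≡ ∣ j ∣
i*i≡j*j⇒∣i∣≡∣j∣ {i} {j} eq =
  m*m≡n*n⇒m≡n (ℤP.+-injective (trans (sym (i*i≡∣i∣*∣i∣ i)) (trans eq (i*i≡∣i∣*∣i∣ j))))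

∣i∣≡∣j∣⇒i*i≡j*j : ∀ {i j} → ∣ i ∣ ≡ ∣ j ∣ → i * i ≡ j * j
∣i∣≡∣j∣⇒i*i≡j*j {i} {j} eq =
  trans (i*i≡∣i∣*∣i∣ i) (trans (cong (λ n → + (n ℕ.* n)) eq) (sym (i*i≡∣i∣*∣i∣ j)))

∣i∣≡1⇒i≡±1 : ∀ {i} → ∣ i ∣ ≡ 1 → i ≡ 1ℤ ⊎ i ≡ -1ℤ
∣i∣≡1⇒i≡±1 {+ .1} refl = inj₁ refl
∣i∣≡1⇒i≡±1 { -[1+ 0 ]} refl = inj₂ refl

i≡±1⇒i*i≡1 : ∀ {i} → i ≡ 1ℤ ⊎ i ≡ -1ℤ → i * i ≡ 1ℤ
i≡±1⇒i*i≡1 (inj₁ refl) = refl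
i≡±1⇒i*i≡1 (inj₂ refl) = refl

∣-lincomb : ∀ {k x y} a c → k ∣ x → k ∣ y → k ∣ x * a + y * c
∣-lincomb a c k∣x k∣y = ∣m∣n⇒∣m+n (∣m⇒∣m*n a k∣x) (∣m⇒∣m*n c k∣y)

∣-neg-*ˡ : ∀ i j → i ∣ - (i * j)
∣-neg-*ˡ i j = ∣m⇒∣-m (∣m⇒∣m*n j ∣-refl)

∣-neg-*ʳ : ∀ i j → i ∣ - (j * i)
∣-neg-*ʳ i j = ∣m⇒∣-m (∣n⇒∣m*n j ∣-refl)

coprime-+⁻ : ∀ {m n} → ℕC.Coprime m (m ℕ.+ n) → ℕC.Coprime m n
coprime-+⁻ c (i∣m , i∣n) = c (i∣m , ℕD.∣m∣n⇒∣m+n i∣m i∣n)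

cross-divides : ∀ s t b r → Coprime b r → s * b + t * r ≡ 0ℤ → b ∣ t
cross-divides s t b r b⊥r sb+tr≡0 = ∣ᵤ⇒∣ {b} {t} (coprime-divisor b r t b⊥r (∣⇒∣ᵤ b∣rt))
  where
  b∣rt : b ∣ r * t
  b∣rt = subst (b ∣_) (sym (trans (ℤP.*-comm r t) (inverseʳ-unique (s * b) (t * r) sb+tr≡0)))
               (∣-neg-*ʳ b s)

cross-∣∣ : ∀ s t b r → Coprime s t → Coprime b r → s * b + t * r ≡ 0ℤ → ∣ s ∣ ≡ ∣ r ∣
cross-∣∣ s t b r s⊥t b⊥r sb+tr≡0 =
  ℕD.∣-antisym (coprime-divisor s t r s⊥t (∣⇒∣ᵤ s∣tr))
               (coprime-divisor r b s (ℤC.sym {b} {r} b⊥r) (∣⇒∣ᵤ r∣bs))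
  where
  s∣tr : s ∣ t * r
  s∣tr = subst (s ∣_) (sym (inverseʳ-unique (s * b) (t * r) sb+tr≡0)) (∣-neg-*ˡ s b)
  r∣bs : r ∣ b * s
  r∣bs = subst (r ∣_) (sym (trans (ℤP.*-comm b s) (inverseˡ-unique (s * b) (t * r) sb+tr≡0)))
               (∣-neg-*ʳ r t)

∣⇒CongMod : ∀ {k m} a c → ∣ k ∣ ≡ m → k ∣ a - c → CongMod m a c
∣⇒CongMod a c ∣k∣≡m k∣a-c = subst (ℕD._∣ ∣ a - c ∣) ∣k∣≡m (∣⇒∣ᵤ k∣a-c)

inverse-identity : ∀ b r s t x y → r * r ≡ s * s → s * y - t * x ≡ 1ℤ →
  r * (b * (x * y) + r * (y * y)) - 1ℤ ≡ b * (r * (x * y)) + t * (x * (+ 2 + t * x))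
inverse-identity b r s t x y r*r≡s*s sy-tx≡1 = begin
  r * (b * (x * y) + r * (y * y)) - 1ℤ
    ≡⟨ solve (b ∷ r ∷ x ∷ y ∷ []) ⟩
  b * (r * (x * y)) + r * r * (y * y) - 1ℤ
    ≡⟨ cong (λ u → b * (r * (x * y)) + u * (y * y) - 1ℤ) r*r≡s*s ⟩
  b * (r * (x * y)) + s * s * (y * y) - 1ℤ
    ≡⟨ solve (b ∷ r ∷ s ∷ t ∷ x ∷ y ∷ []) ⟩
  b * (r * (x * y)) + (s * y - t * x + t * x) * (s * y - t * x + t * x) - 1ℤ
    ≡⟨ cong (λ u → b * (r * (x * y)) + (u + t * x) * (u + t * x) - 1ℤ) sy-tx≡1 ⟩
  b * (r * (x * y)) + (1ℤ + t * x) * (1ℤ + t * x) - 1ℤ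
    ≡⟨ solve (b ∷ r ∷ t ∷ x ∷ y ∷ []) ⟩
  b * (r * (x * y)) + t * (x * (+ 2 + t * x))
    ∎

sgn : ℤ → ℤ
sgn (+ _) = 1ℤ
sgn -[1+ _ ] = -1ℤ

sgn-* : ∀ i → sgn i * i ≡ + ∣ i ∣
sgn-* (+ n) = ℤP.*-identityˡ (+ n)
sgn-* -[1+ n ] = ℤP.-1*i≡-i -[1+ n ]

1+ab≡cd⇒cd-ab≡1 : ∀ {a b c d} → 1 ℕ.+ a ℕ.* b ≡ c ℕ.* d → + c * + d + (- + a) * + b ≡ 1ℤ
1+ab≡cd⇒cd-ab≡1 {a} {b} {c} {d} eq = begin
  + c * + d + (- + a) * + b         ≡⟨ cong (_+ (- + a) * + b) (sym eqℤ) ⟩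
  1ℤ + + a * + b + (- + a) * + b    ≡⟨ cancel (+ a) (+ b) ⟩
  1ℤ                                ∎
  where
  eqℤ : 1ℤ + + a * + b ≡ + c * + d
  eqℤ = trans (cong (λ p → 1ℤ + p) (sym (ℤP.pos-* a b)))
              (trans (cong (λ n → + n) eq) (ℤP.pos-* c d))
  cancel : ∀ a b → 1ℤ + a * b + (- a) * b ≡ 1ℤ
  cancel = solve-∀

bézout-ℕ : ∀ {m n} → ℕC.Coprime m n → Σ ℤ λ u → Σ ℤ λ v → u * + m + v * + n ≡ 1ℤ
bézout-ℕ {m} {n} c with ℕC.coprime-Bézout c
... | Bézout.+- x y eq = + x , - + y , 1+ab≡cd⇒cd-ab≡1 {y} {n} {x} {m} eq
... | Bézout.-+ x y eq =
  - + x , + y , trans (ℤP.+-comm (- + x * + m) (+ y * + n)) (1+ab≡cd⇒cd-ab≡1 {x} {m} {y} {n} eq)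

bézout : ∀ {a b} → Coprime a b → Σ ℤ λ u → Σ ℤ λ v → u * a + v * b ≡ 1ℤ
bézout {a} {b} c =
  let u , v , eq = bézout-ℕ c in
  u * sgn a , v * sgn b , (begin
    u * sgn a * a + v * sgn b * b      ≡⟨ cong₂ _+_ (ℤP.*-assoc u (sgn a) a) (ℤP.*-assoc v (sgn b) b) ⟩
    u * (sgn a * a) + v * (sgn b * b)  ≡⟨ cong₂ (λ p q → u * p + v * q) (sgn-* a) (sgn-* b) ⟩
    u * + ∣ a ∣ + v * + ∣ b ∣           ≡⟨ eq ⟩
    1ℤ                                 ∎)

-- The lattice ℤ² of regions

infix 25 _∙_

_∙_ : ℤ → V → V
k ∙ (a , b) = (k * a , k * b)

neg-involutive : ∀ v → neg (neg v) ≡ v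
neg-involutive (a , b) = cong₂ _,_ (ℤP.neg-involutive a) (ℤP.neg-involutive b)

1∙v≡v : ∀ v → 1ℤ ∙ v ≡ v
1∙v≡v (a , b) = cong₂ _,_ (ℤP.*-identityˡ a) (ℤP.*-identityˡ b)

⊕-⊖-cancelʳ : ∀ v w → (v ⊕ w) ⊖ w ≡ v
⊕-⊖-cancelʳ (a , b) (c , e) = cong₂ _,_ (component a c) (component b e)
  where
  component : ∀ a c → a + c - c ≡ a
  component = solve-∀

⊖-⊕-cancelˡ : ∀ v w → v ⊖ (v ⊕ w) ≡ neg w
⊖-⊕-cancelˡ (a , b) (c , e) = cong₂ _,_ (component a c) (component b e)
  where
  component : ∀ a c → a - (a + c) ≡ - c
  component = solve-∀

⊖-neg : ∀ v w → w ⊖ neg v ≡ v ⊕ w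
⊖-neg (a , b) (c , e) = cong₂ _,_ (component a c) (component b e)
  where
  component : ∀ a c → c - - a ≡ a + c
  component = solve-∀

1∙⊕0∙ : ∀ v w → 1ℤ ∙ v ⊕ 0ℤ ∙ w ≡ v
1∙⊕0∙ (a , b) (c , e) = cong₂ _,_ (component a c) (component b e)
  where
  component : ∀ a c → 1ℤ * a + 0ℤ * c ≡ a
  component = solve-∀

0∙⊕1∙ : ∀ v w → 0ℤ ∙ v ⊕ 1ℤ ∙ w ≡ w
0∙⊕1∙ (a , b) (c , e) = cong₂ _,_ (component a c) (component b e)
  where
  component : ∀ a c → 0ℤ * a + 1ℤ * c ≡ c
  component = solve-∀

-1∙⊕0∙ : ∀ v w → -1ℤ ∙ v ⊕ 0ℤ ∙ w ≡ neg v
-1∙⊕0∙ (a , b) (c , e) = cong₂ _,_ (component a c) (component b e)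
  where
  component : ∀ a c → -1ℤ * a + 0ℤ * c ≡ - a
  component = solve-∀

∙⊕∙-shiftˡ : ∀ x d v w → x ∙ v ⊕ (x + d) ∙ w ≡ x ∙ (v ⊕ w) ⊕ d ∙ w
∙⊕∙-shiftˡ x d (a , b) (c , e) = cong₂ _,_ (component x d a c) (component x d b e)
  where
  component : ∀ x d a c → x * a + (x + d) * c ≡ x * (a + c) + d * c
  component = solve-∀

∙⊕∙-shiftʳ : ∀ y d v w → (y + d) ∙ v ⊕ y ∙ w ≡ d ∙ v ⊕ y ∙ (v ⊕ w)
∙⊕∙-shiftʳ y d (a , b) (c , e) = cong₂ _,_ (component y d a c) (component y d b e)
  where
  component : ∀ y d a c → (y + d) * a + y * c ≡ d * a + y * (a + c)
  component = solve-∀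

∙⊕∙-rotate : ∀ x y v w → y ∙ w ⊕ (- x) ∙ neg v ≡ x ∙ v ⊕ y ∙ w
∙⊕∙-rotate x y (a , b) (c , e) = cong₂ _,_ (component x y a c) (component x y b e)
  where
  component : ∀ x y a c → y * c + (- x) * (- a) ≡ x * a + y * c
  component = solve-∀

neg-∙⊕∙ : ∀ x y v w → neg (x ∙ v ⊕ y ∙ w) ≡ (- x) ∙ v ⊕ (- y) ∙ w
neg-∙⊕∙ x y (a , b) (c , e) = cong₂ _,_ (component x y a c) (component x y b e)
  where
  component : ∀ x y a c → - (x * a + y * c) ≡ (- x) * a + (- y) * c
  component = solve-∀

∙⊕∙-det : ∀ v w z → det z w ∙ v ⊕ det v z ∙ w ≡ det v w ∙ z
∙⊕∙-det (a , b) (c , e) (z₁ , z₂) = cong₂ _,_ (cramer₁ a b c e z₁ z₂) (cramer₂ a b c e z₁ z₂)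
  where
  cramer₁ : ∀ a b c e z₁ z₂ → (z₁ * e - z₂ * c) * a + (a * z₂ - b * z₁) * c ≡ (a * e - b * c) * z₁
  cramer₁ = solve-∀
  cramer₂ : ∀ a b c e z₁ z₂ → (z₁ * e - z₂ * c) * b + (a * z₂ - b * z₁) * e ≡ (a * e - b * c) * z₂
  cramer₂ = solve-∀

coordinates : ∀ {v w} z → det v w ≡ 1ℤ → z ≡ det z w ∙ v ⊕ det v z ∙ w
coordinates {v} {w} z h = sym (trans (∙⊕∙-det v w z) (trans (cong (_∙ z) h) (1∙v≡v z)))

det-⊕ˡ : ∀ v w → det (v ⊕ w) w ≡ det v w
det-⊕ˡ (a , b) (c , e) = shear a b c e
  where
  shear : ∀ a b c e → (a + c) * e - (b + e) * c ≡ a * e - b * c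
  shear = solve-∀

det-⊕ʳ : ∀ v w → det v (v ⊕ w) ≡ det v w
det-⊕ʳ (a , b) (c , e) = shear a b c e
  where
  shear : ∀ a b c e → a * (b + e) - b * (a + c) ≡ a * e - b * c
  shear = solve-∀

det-rotate : ∀ v w → det w (neg v) ≡ det v w
det-rotate (a , b) (c , e) = rotate a b c e
  where
  rotate : ∀ a b c e → c * - b - e * - a ≡ a * e - b * c
  rotate = solve-∀

det-plücker : ∀ a b c d → det c b * det a d - det a c * det d b ≡ det c d * det a b
det-plücker (a₁ , a₂) (b₁ , b₂) (c₁ , c₂) (d₁ , d₂) = plücker a₁ a₂ b₁ b₂ c₁ c₂ d₁ d₂
  where
  plücker : ∀ a₁ a₂ b₁ b₂ c₁ c₂ d₁ d₂ →
    (c₁ * b₂ - c₂ * b₁) * (a₁ * d₂ - a₂ * d₁) - (a₁ * c₂ - a₂ * c₁) * (d₁ * b₂ - d₂ * b₁)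
    ≡ (c₁ * d₂ - c₂ * d₁) * (a₁ * b₂ - a₂ * b₁)
  plücker = solve-∀

det≡1⇒regionˡ : ∀ v w → det v w ≡ 1ℤ → IsRegion v
det≡1⇒regionˡ (a , b) (c , e) h =
  cong +_ (ℕD.∣1⇒≡1 (subst (Unsigned._∣_ (gcd a b)) h (∣⇒∣ᵤ g∣det)))
  where
  g∣det : gcd a b ∣ a * e - b * c
  g∣det = ∣m∣n⇒∣m-n (∣m⇒∣m*n e (∣ᵤ⇒∣ {gcd a b} {a} (gcd[i,j]∣i a b)))
                    (∣m⇒∣m*n c (∣ᵤ⇒∣ {gcd a b} {b} (gcd[i,j]∣j a b)))

det≡1⇒regionʳ : ∀ v w → det v w ≡ 1ℤ → IsRegion w
det≡1⇒regionʳ v w h = det≡1⇒regionˡ w (neg v) (trans (det-rotate v w) h)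

region⇒coprime : ∀ x y v w → IsRegion (x ∙ v ⊕ y ∙ w) → Coprime x y
region⇒coprime x y (a , b) (c , e) reg {i} (i∣x , i∣y) =
  ℕD.∣1⇒≡1 (subst (Unsigned._∣_ (+ i)) reg
    (gcd-greatest {x * a + y * c} {x * b + y * e} {+ i} (∣⇒∣ᵤ (i∣comb a c)) (∣⇒∣ᵤ (i∣comb b e))))
  where
  i∣comb : ∀ a c → + i ∣ x * a + y * c
  i∣comb a c = ∣-lincomb a c (∣ᵤ⇒∣ {+ i} {x} i∣x) (∣ᵤ⇒∣ {+ i} {y} i∣y)

basis-completion : ∀ {v} → IsRegion v → Σ V λ w → det v w ≡ 1ℤ
basis-completion {p , q} reg =
  let u , u′ , eq = bézout {p} {q} (ℕC.gcd≡1⇒coprime (ℤP.+-injective reg)) in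
  (- u′ , u) , trans (rearrange p q u u′) eq
  where
  rearrange : ∀ p q u u′ → p * u - q * (- u′) ≡ u * p + u′ * q
  rearrange = solve-∀

det≡0⇒≡± : ∀ {v u} z → det v u ≡ 1ℤ → IsRegion z → det v z ≡ 0ℤ → z ≡ v ⊎ z ≡ neg v
det≡0⇒≡± {v} {u} z h reg d≡0 =
  Sum.map (λ k≡1 → trans z≡ (trans (cong (λ k → k ∙ v ⊕ 0ℤ ∙ u) k≡1) (1∙⊕0∙ v u)))
          (λ k≡-1 → trans z≡ (trans (cong (λ k → k ∙ v ⊕ 0ℤ ∙ u) k≡-1) (-1∙⊕0∙ v u)))
          (∣i∣≡1⇒i≡±1 {det z u} (ℕC.0-coprimeTo-m⇒m≡1 (ℕC.sym z⊥0)))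
  where
  z≡ : z ≡ det z u ∙ v ⊕ 0ℤ ∙ u
  z≡ = trans (coordinates z h) (cong (λ t → det z u ∙ v ⊕ t ∙ u) d≡0)
  z⊥0 : Coprime (det z u) 0ℤ
  z⊥0 = region⇒coprime (det z u) 0ℤ v u (subst IsRegion z≡ reg)

-- A topograph is a binary quadratic form

form : ℤ → ℤ → ℤ → ℤ → ℤ → ℤ
form a b c x y = a * (x * x) + b * (x * y) + c * (y * y)

-- Stated with form unfolded, because the ring solver does not unfold definitions.

form-e₁ : ∀ a b c → a * (1ℤ * 1ℤ) + b * (1ℤ * 0ℤ) + c * (0ℤ * 0ℤ) ≡ a
form-e₁ = solve-∀

form-e₂ : ∀ a b c → a * (0ℤ * 0ℤ) + b * (0ℤ * 1ℤ) + c * (1ℤ * 1ℤ) ≡ c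
form-e₂ = solve-∀

form-shiftˡ : ∀ a b c x d →
  (a + b + c) * (x * x) + (b + + 2 * c) * (x * d) + c * (d * d)
  ≡ a * (x * x) + b * (x * (x + d)) + c * ((x + d) * (x + d))
form-shiftˡ = solve-∀

form-shiftʳ : ∀ a b c y d →
  a * (d * d) + (+ 2 * a + b) * (d * y) + (a + b + c) * (y * y)
  ≡ a * ((y + d) * (y + d)) + b * ((y + d) * y) + c * (y * y)
form-shiftʳ = solve-∀

form-rotate : ∀ a b c x y →
  c * (y * y) + (- b) * (y * - x) + a * (- x * - x) ≡ a * (x * x) + b * (x * y) + c * (y * y)
form-rotate = solve-∀

form-neg : ∀ a b c x y →
  a * (- x * - x) + b * (- x * - y) + c * (- y * - y) ≡ a * (x * x) + b * (x * y) + c * (y * y)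
form-neg = solve-∀

form-lake : ∀ b c x y → 0ℤ * (x * x) + b * (x * y) + c * (y * y) ≡ b * (x * y) + c * (y * y)
form-lake = solve-∀

module Topograph {f : Labelling} (topograph : IsTopograph f) where

  private
    f-neg : ∀ v → IsRegion v → f (neg v) ≡ f v
    f-neg = proj₁ topograph

    f-edge : ∀ v w → det v w ≡ 1ℤ → f (v ⊕ w) + f (v ⊖ w) ≡ + 2 * (f v + f w)
    f-edge = proj₂ topograph

  formAt : V → V → ℤ → ℤ → ℤ
  formAt v w = form (f v) (edgeLabel f v w) (f w)

  f-⊕ : ∀ {v w} → det v w ≡ 1ℤ → f (v ⊕ w) ≡ f v + edgeLabel f v w + f w
  f-⊕ {v} {w} h = begin
    f (v ⊕ w)                          ≡⟨ add-sub (f (v ⊕ w)) (f (v ⊖ w)) ⟩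
    f (v ⊕ w) + f (v ⊖ w) - f (v ⊖ w)  ≡⟨ cong (_- f (v ⊖ w)) (f-edge v w h) ⟩
    + 2 * (f v + f w) - f (v ⊖ w)      ≡⟨ regroup (f v) (f w) (f (v ⊖ w)) ⟩
    f v + edgeLabel f v w + f w        ∎
    where
    add-sub : ∀ p s → p ≡ p + s - s
    add-sub = solve-∀
    regroup : ∀ a c s → + 2 * (a + c) - s ≡ a + (a + c - s) + c
    regroup = solve-∀

  label-shiftˡ : ∀ {v w} → det v w ≡ 1ℤ → edgeLabel f (v ⊕ w) w ≡ edgeLabel f v w + + 2 * f w
  label-shiftˡ {v} {w} h = begin
    f (v ⊕ w) + f w - f ((v ⊕ w) ⊖ w)  ≡⟨ cong (λ u → f (v ⊕ w) + f w - f u) (⊕-⊖-cancelʳ v w) ⟩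
    f (v ⊕ w) + f w - f v              ≡⟨ cong (λ p → p + f w - f v) (f-⊕ h) ⟩
    f v + b + f w + f w - f v          ≡⟨ regroup (f v) b (f w) ⟩
    b + + 2 * f w                      ∎
    where
    b : ℤ
    b = edgeLabel f v w
    regroup : ∀ a b c → a + b + c + c - a ≡ b + + 2 * c
    regroup = solve-∀

  label-shiftʳ : ∀ {v w} → det v w ≡ 1ℤ → edgeLabel f v (v ⊕ w) ≡ + 2 * f v + edgeLabel f v w
  label-shiftʳ {v} {w} h = begin
    f v + f (v ⊕ w) - f (v ⊖ (v ⊕ w))  ≡⟨ cong (λ u → f v + f (v ⊕ w) - f u) (⊖-⊕-cancelˡ v w) ⟩
    f v + f (v ⊕ w) - f (neg w)        ≡⟨ cong₂ (λ p q → f v + p - q) (f-⊕ h) f[-w]≡f[w] ⟩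
    f v + (f v + b + f w) - f w        ≡⟨ regroup (f v) b (f w) ⟩
    + 2 * f v + b                      ∎
    where
    b : ℤ
    b = edgeLabel f v w
    f[-w]≡f[w] : f (neg w) ≡ f w
    f[-w]≡f[w] = f-neg w (det≡1⇒regionʳ v w h)
    regroup : ∀ a b c → a + (a + b + c) - c ≡ + 2 * a + b
    regroup = solve-∀

  label-rotate : ∀ {v w} → det v w ≡ 1ℤ → edgeLabel f w (neg v) ≡ - edgeLabel f v w
  label-rotate {v} {w} h = begin
    f w + f (neg v) - f (w ⊖ neg v)  ≡⟨ cong₂ (λ p u → f w + p - f u) f[-v]≡f[v] (⊖-neg v w) ⟩
    f w + f v - f (v ⊕ w)            ≡⟨ cong (λ p → f w + f v - p) (f-⊕ h) ⟩
    f w + f v - (f v + b + f w)      ≡⟨ regroup (f v) b (f w) ⟩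
    - b                              ∎
    where
    b : ℤ
    b = edgeLabel f v w
    f[-v]≡f[v] : f (neg v) ≡ f v
    f[-v]≡f[v] = f-neg v (det≡1⇒regionˡ v w h)
    regroup : ∀ a b c → c + a - (a + b + c) ≡ - b
    regroup = solve-∀

  formAt-shiftˡ : ∀ {v w} x d → det v w ≡ 1ℤ → formAt (v ⊕ w) w x d ≡ formAt v w x (x + d)
  formAt-shiftˡ {v} {w} x d h =
    trans (cong₂ (λ a b → form a b (f w) x d) (f-⊕ h) (label-shiftˡ h))
          (form-shiftˡ (f v) (edgeLabel f v w) (f w) x d)

  formAt-shiftʳ : ∀ {v w} y d → det v w ≡ 1ℤ → formAt v (v ⊕ w) d y ≡ formAt v w (y + d) y
  formAt-shiftʳ {v} {w} y d h =
    trans (cong₂ (λ b c → form (f v) b c d y) (label-shiftʳ h) (f-⊕ h))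
          (form-shiftʳ (f v) (edgeLabel f v w) (f w) y d)

  formAt-rotate : ∀ {v w} x y → det v w ≡ 1ℤ → formAt w (neg v) y (- x) ≡ formAt v w x y
  formAt-rotate {v} {w} x y h =
    trans (cong₂ (λ b a → form (f w) b a y (- x)) (label-rotate h) (f-neg v (det≡1⇒regionˡ v w h)))
          (form-rotate (f v) (edgeLabel f v w) (f w) x y)

  -- Subtractive Euclid: (x, x + d) in the basis (v, w) is (x, d) in the adjacent basis
  -- (v ⊕ w, w), and (y + d, y) is (d, y) in (v, v ⊕ w).
  f≡formAt-ℕ : ∀ {x y} → Acc ℕ._<_ (x ℕ.+ y) → ℕC.Coprime x y → ∀ {v w} → det v w ≡ 1ℤ →
               f ((+ x) ∙ v ⊕ (+ y) ∙ w) ≡ formAt v w (+ x) (+ y)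
  f≡formAt-ℕ {zero} _ c {v} {w} _ with refl ← ℕC.0-coprimeTo-m⇒m≡1 c =
    trans (cong f (0∙⊕1∙ v w)) (sym (form-e₂ (f v) (edgeLabel f v w) (f w)))
  f≡formAt-ℕ {suc x} {zero} _ c {v} {w} _ with refl ← ℕC.0-coprimeTo-m⇒m≡1 (ℕC.sym c) =
    trans (cong f (1∙⊕0∙ v w)) (sym (form-e₁ (f v) (edgeLabel f v w) (f w)))
  f≡formAt-ℕ {suc x} {suc y} (acc smaller) c {v} {w} h with ℕP.≤-total x y
  ... | inj₁ x≤y with d , refl ← ℕP.m≤n⇒∃[o]m+o≡n x≤y = begin
    f ((+ suc x) ∙ v ⊕ (+ suc (x ℕ.+ d)) ∙ w)
      ≡⟨ cong f (∙⊕∙-shiftˡ (+ suc x) (+ d) v w) ⟩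
    f ((+ suc x) ∙ (v ⊕ w) ⊕ (+ d) ∙ w)
      ≡⟨ f≡formAt-ℕ (smaller (ℕP.+-monoʳ-< (suc x) (ℕ.s≤s (ℕP.m≤n+m d x))))
                    (coprime-+⁻ c) (trans (det-⊕ˡ v w) h) ⟩
    formAt (v ⊕ w) w (+ suc x) (+ d)
      ≡⟨ formAt-shiftˡ (+ suc x) (+ d) h ⟩
    formAt v w (+ suc x) (+ suc (x ℕ.+ d))
      ∎
  ... | inj₂ y≤x with d , refl ← ℕP.m≤n⇒∃[o]m+o≡n y≤x = begin
    f ((+ suc (y ℕ.+ d)) ∙ v ⊕ (+ suc y) ∙ w)
      ≡⟨ cong f (∙⊕∙-shiftʳ (+ suc y) (+ d) v w) ⟩
    f ((+ d) ∙ v ⊕ (+ suc y) ∙ (v ⊕ w))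
      ≡⟨ f≡formAt-ℕ (smaller (ℕP.+-monoˡ-< (suc y) (ℕ.s≤s (ℕP.m≤n+m d y))))
                    (ℕC.sym (coprime-+⁻ (ℕC.sym c))) (trans (det-⊕ʳ v w) h) ⟩
    formAt v (v ⊕ w) (+ d) (+ suc y)
      ≡⟨ formAt-shiftʳ (+ suc y) (+ d) h ⟩
    formAt v w (+ suc (y ℕ.+ d)) (+ suc y)
      ∎

  f≡formAt⁺ : ∀ x q → Coprime x (+ q) → ∀ {v w} → det v w ≡ 1ℤ →
              f (x ∙ v ⊕ (+ q) ∙ w) ≡ formAt v w x (+ q)
  f≡formAt⁺ (+ p) q c h = f≡formAt-ℕ (<-wellFounded _) c h
  f≡formAt⁺ -[1+ p ] q c {v} {w} h = begin
    f (-[1+ p ] ∙ v ⊕ (+ q) ∙ w)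
      ≡⟨ cong f (∙⊕∙-rotate -[1+ p ] (+ q) v w) ⟨
    f ((+ q) ∙ w ⊕ (+ suc p) ∙ neg v)
      ≡⟨ f≡formAt-ℕ (<-wellFounded _) (ℕC.sym c) (trans (det-rotate v w) h) ⟩
    formAt w (neg v) (+ q) (+ suc p)
      ≡⟨ formAt-rotate -[1+ p ] (+ q) h ⟩
    formAt v w -[1+ p ] (+ q)
      ∎

  f≡formAt : ∀ {v w} x y → det v w ≡ 1ℤ → IsRegion (x ∙ v ⊕ y ∙ w) →
             f (x ∙ v ⊕ y ∙ w) ≡ formAt v w x y
  f≡formAt {v} {w} x (+ q) h reg = f≡formAt⁺ x q (region⇒coprime x (+ q) v w reg) h
  f≡formAt {v} {w} x -[1+ q ] h reg = begin
    f (x ∙ v ⊕ -[1+ q ] ∙ w)          ≡⟨ f-neg _ reg ⟨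
    f (neg (x ∙ v ⊕ -[1+ q ] ∙ w))    ≡⟨ cong f (neg-∙⊕∙ x -[1+ q ] v w) ⟩
    f ((- x) ∙ v ⊕ (+ suc q) ∙ w)     ≡⟨ f≡formAt⁺ (- x) (suc q) -x⊥q h ⟩
    formAt v w (- x) (+ suc q)        ≡⟨ form-neg (f v) (edgeLabel f v w) (f w) x -[1+ q ] ⟩
    formAt v w x -[1+ q ]             ∎
    where
    -x⊥q : Coprime (- x) (+ suc q)
    -x⊥q = subst (λ n → ℕC.Coprime n (suc q)) (sym (ℤP.∣-i∣≡∣i∣ x))
                 (region⇒coprime x -[1+ q ] v w reg)

-- Lakes

module Lake {f : Labelling} (topograph : IsTopograph f) {L : V} (isLake : IsLake f L) where
  open Topograph topograph

  w : V
  w = proj₁ (basis-completion {L} (proj₁ isLake))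

  basis : det L w ≡ 1ℤ
  basis = proj₂ (basis-completion {L} (proj₁ isLake))

  b r : ℤ
  b = edgeLabel f L w
  r = f w

  f-value : ∀ z → IsRegion z → f z ≡ b * (det z w * det L z) + r * (det L z * det L z)
  f-value z reg = begin
    f z                                ≡⟨ cong f z≡ ⟩
    f (det z w ∙ L ⊕ det L z ∙ w)      ≡⟨ f≡formAt (det z w) (det L z) basis (subst IsRegion z≡ reg) ⟩
    form (f L) b r (det z w) (det L z) ≡⟨ cong (λ a → form a b r (det z w) (det L z)) (proj₂ isLake) ⟩
    form 0ℤ b r (det z w) (det L z)    ≡⟨ form-lake b r (det z w) (det L z) ⟩
    b * (det z w * det L z) + r * (det L z * det L z) ∎
    where
    z≡ : z ≡ det z w ∙ L ⊕ det L z ∙ w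
    z≡ = coordinates z basis

  discAt≡b*b : discAt f L w ≡ b * b
  discAt≡b*b = begin
    b * b - + 4 * f L * r  ≡⟨ cong (λ a → b * b - + 4 * a * r) (proj₂ isLake) ⟩
    b * b - + 4 * 0ℤ * r   ≡⟨ drop-zero b r ⟩
    b * b                  ∎
    where
    drop-zero : ∀ b r → b * b - + 4 * 0ℤ * r ≡ b * b
    drop-zero = solve-∀

  ∣b∣≡m : ∀ {m} → HasDiscriminant f (+ m * + m) → ∣ b ∣ ≡ m
  ∣b∣≡m {m} disc = i*i≡j*j⇒∣i∣≡∣j∣ {b} {+ m} (trans (sym discAt≡b*b) (disc L w basis))

  neighbour≡r : ∀ {m} → HasDiscriminant f (+ m * + m) →
                ∀ z → IsRegion z → Adjacent L z → CongMod m (f z) r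
  neighbour≡r disc z reg adj =
    ∣⇒CongMod (f z) r (∣b∣≡m disc) (subst (b ∣_) (sym fz-r≡bxy) (∣m⇒∣m*n (x * y) ∣-refl))
    where
    x y : ℤ
    x = det z w
    y = det L z
    fz-r≡bxy : f z - r ≡ b * (x * y)
    fz-r≡bxy = begin
      f z - r                        ≡⟨ cong (_- r) (f-value z reg) ⟩
      b * (x * y) + r * (y * y) - r  ≡⟨ cong (λ u → b * (x * y) + r * u - r) (i≡±1⇒i*i≡1 adj) ⟩
      b * (x * y) + r * 1ℤ - r       ≡⟨ cancel (b * (x * y)) r ⟩
      b * (x * y)                    ∎
      where
      cancel : ∀ p r → p + r * 1ℤ - r ≡ p
      cancel = solve-∀

  primitive⇒coprime : Primitive f → Coprime b r
  primitive⇒coprime prim {i} (i∣b , i∣r) = ℕD.∣1⇒≡1 (prim (+ i) i∣values)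
    where
    i∣values : ∀ z → IsRegion z → Unsigned._∣_ (+ i) (f z)
    i∣values z reg = ∣⇒∣ᵤ (subst (+ i ∣_) (sym (f-value z reg))
      (∣-lincomb (det z w * det L z) (det L z * det L z) (∣ᵤ⇒∣ {+ i} {b} i∣b) (∣ᵤ⇒∣ {+ i} {r} i∣r)))

  other-lake : ∀ {L′} → IsLake f L′ → DistinctRegions L L′ → det L′ w * b + det L L′ * r ≡ 0ℤ
  other-lake {L′} (region′ , lake′) distinct =
    [ (λ t≡0 → ⊥-elim (t≢0 t≡0)) , id ]′ (ℤP.i*j≡0⇒i≡0∨j≡0 t (begin
      t * (s * b + t * r)        ≡⟨ factor t s b r ⟩
      b * (s * t) + r * (t * t)  ≡⟨ f-value L′ region′ ⟨
      f L′                       ≡⟨ lake′ ⟩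
      0ℤ                         ∎))
    where
    s t : ℤ
    s = det L′ w
    t = det L L′
    factor : ∀ t s b r → t * (s * b + t * r) ≡ b * (s * t) + r * (t * t)
    factor = solve-∀
    t≢0 : t ≢ 0ℤ
    t≢0 t≡0 = [ (λ L′≡L → proj₁ distinct (sym L′≡L))
              , (λ L′≡-L → proj₂ distinct (trans (sym (neg-involutive L)) (cong neg (sym L′≡-L))))
              ]′ (det≡0⇒≡± L′ basis region′ t≡0)

  r*f[w′]≡1 : ∀ {m} → HasDiscriminant f (+ m * + m) → Primitive f →
              ∀ {L′ w′} → IsLake f L′ → DistinctRegions L L′ → det L′ w′ ≡ 1ℤ →
              CongMod m (r * f w′) 1ℤ
  r*f[w′]≡1 disc prim {L′} {w′} lake′ distinct basis′ =
    ∣⇒CongMod (r * f w′) 1ℤ (∣b∣≡m disc)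
      (subst (b ∣_) (sym r*fw′-1) (∣-lincomb (r * (x * y)) (x * (+ 2 + t * x)) ∣-refl b∣t))
    where
    s t x y : ℤ
    s = det L′ w
    t = det L L′
    x = det w′ w
    y = det L w′

    s⊥t : Coprime s t
    s⊥t = region⇒coprime s t L w (subst IsRegion (coordinates L′ basis) (proj₁ lake′))

    b∣t : b ∣ t
    b∣t = cross-divides s t b r (primitive⇒coprime prim) (other-lake lake′ distinct)

    r*r≡s*s : r * r ≡ s * s
    r*r≡s*s = sym (∣i∣≡∣j∣⇒i*i≡j*j {s} {r}
      (cross-∣∣ s t b r s⊥t (primitive⇒coprime prim) (other-lake lake′ distinct)))

    sy-tx≡1 : s * y - t * x ≡ 1ℤ
    sy-tx≡1 = trans (det-plücker L w L′ w′) (cong₂ _*_ basis′ basis)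

    r*fw′-1 : r * f w′ - 1ℤ ≡ b * (r * (x * y)) + t * (x * (+ 2 + t * x))
    r*fw′-1 = begin
      r * f w′ - 1ℤ
        ≡⟨ cong (λ u → r * u - 1ℤ) (f-value w′ (det≡1⇒regionʳ L′ w′ basis′)) ⟩
      r * (b * (x * y) + r * (y * y)) - 1ℤ
        ≡⟨ inverse-identity b r s t x y r*r≡s*s sy-tx≡1 ⟩
      b * (r * (x * y)) + t * (x * (+ 2 + t * x))
        ∎

-- m ≥ 1 is unused: for m = 0, b = 0 forces r = ±1, and then f(L′) = t²r ≠ 0.
proposition6p10 : (f : Labelling) → IsTopograph f → Primitive f →
    (m : ℕ) → m ≥ 1 → HasDiscriminant f (+ m * + m) →
    (L₁ L₂ : V) → IsLake f L₁ → IsLake f L₂ → DistinctRegions L₁ L₂ →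
    Σ ℤ λ r → Σ ℤ λ s →
      CongMod m (r * s) 1ℤ ×
      (∀ w → IsRegion w → Adjacent L₁ w → CongMod m (f w) r) ×
      (∀ w → IsRegion w → Adjacent L₂ w → CongMod m (f w) s)
proposition6p10 f topograph prim m _ disc L₁ L₂ lake₁ lake₂ distinct =
  Lake₁.r , Lake₂.r ,
  Lake₁.r*f[w′]≡1 disc prim lake₂ distinct Lake₂.basis ,
  Lake₁.neighbour≡r disc ,
  Lake₂.neighbour≡r disc
  where
  module Lake₁ = Lake topograph lake₁
  module Lake₂ = Lake topograph lake₂
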